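{- Let $f_1(x),f_2(x),g_1(x),g_2(x)\in\mathbb{Z}[x]$ with $f_1(0)\neq0$, $f_2(0)\neq0$ and $g_2\neq0$, and suppose $\left(f_1(x)/f_2(x)\right)^n=g_1(x^k)/g_2(x^k)$ for positive integers $k$ and $n$. Then there exist $h_1(x),h_2(x)\in\mathbb{Z}[x]$ such that $f_1(x)/f_2(x)=h_1(x^k)/h_2(x^k)$. -}

module Defs where

open import Data.Nat using (ℕ; zero; suc; _∸_)
open import Data.Integer using (ℤ; 0ℤ; 1ℤ) renaming (_+_ to _+ℤ_; _*_ to _*ℤ_)
open import Data.List using (List; []; _∷_; replicate; _++_)
open import Relation.Binary.PropositionalEquality using (_≡_)

-- Polynomials in ℤ[x], represented by coefficient lists, lowest degree first:
-- a₀ ∷ a₁ ∷ … ∷ [] represents a₀ + a₁ x + a₂ x² + …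
-- Trailing zeros are allowed; equality of polynomials is coefficientwise (_≈ₚ_).
Poly : Set
Poly = List ℤ

coeff : Poly → ℕ → ℤ
coeff []       _       = 0ℤ
coeff (a ∷ p) zero    = a
coeff (a ∷ p) (suc i) = coeff p i

_≈ₚ_ : Poly → Poly → Set
p ≈ₚ q = ∀ i → coeff p i ≡ coeff q i

0ₚ : Poly
0ₚ = []

1ₚ : Poly
1ₚ = 1ℤ ∷ []

eval0 : Poly → ℤ
eval0 p = coeff p 0

_+ₚ_ : Poly → Poly → Poly
[]      +ₚ q       = q
(a ∷ p) +ₚ []      = a ∷ p
(a ∷ p) +ₚ (b ∷ q) = (a +ℤ b) ∷ (p +ₚ q)

_·ₚ_ : ℤ → Poly → Poly
c ·ₚ []      = []
c ·ₚ (a ∷ p) = (c *ℤ a) ∷ (c ·ₚ p)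

_*ₚ_ : Poly → Poly → Poly
[]      *ₚ q = []
(a ∷ p) *ₚ q = (a ·ₚ q) +ₚ (0ℤ ∷ (p *ₚ q))

_^ₚ_ : Poly → ℕ → Poly
p ^ₚ zero    = 1ₚ
p ^ₚ (suc n) = p *ₚ (p ^ₚ n)

-- substitution x ↦ x^(suc m) : p(x) ↦ p(x^(suc m))
-- (a₀ + a₁ x + …) ↦ a₀ + a₁ x^k + …, i.e. insert m zeros after each coefficient
substPow : ℕ → Poly → Poly
substPow m []      = []
substPow m (a ∷ p) = a ∷ (replicate m 0ℤ ++ substPow m p)

-- p(x^k) for k ≥ 1 (used with k = suc m ≥ 1; the statement assumes k > 0)
_∘xpow_ : Poly → ℕ → Poly
p ∘xpow k = substPow (k ∸ 1) p

-- Write F for the part of f ∈ ℤ[x] supported on degrees divisible by k, so that F = h(xᵏ) with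
-- h = decimate f. Put X = f₁F₂ and Y = F₁f₂: both have constant term c = f₁(0)f₂(0) ≠ 0, and
-- X − Y = (f₁ − F₁)F₂ − F₁(f₂ − F₂) has no monomial of degree divisible by k. Multiplying the
-- hypothesis f₁ⁿG₂ = G₁f₂ⁿ (Gᵢ = gᵢ(xᵏ)) by F₁ⁿF₂ⁿ gives XⁿH₂ = YⁿH₁ with H₁, H₂ ∈ ℤ[xᵏ] and
-- H₂ ≠ 0, hence Yⁿ(H₁ − H₂) = (X − Y)·S·H₂ where S = Σ XⁱYⁿ⁻¹⁻ⁱ has constant term ncⁿ⁻¹ ≠ 0.
-- On the left the lowest nonzero degree (if any) is a multiple of k; on the right it is
-- ord(X − Y) + ord H₂, which is not, unless X = Y. Thus f₁F₂ = F₁f₂.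

module Submission where

open import Defs
open import Data.Nat using (ℕ; zero; suc; _+_; _*_; _<_; z≤n; s≤s; _>_)
import Data.Nat.Properties as ℕP
open import Data.Nat.Divisibility using (_∣_; divides; _∣?_; _∣0; ∣-refl; ∣m∣n⇒∣m+n; ∣m+n∣m⇒∣n)
open import Relation.Nullary.Decidable using (decidable-stable)
open import Data.Integer as ℤ using (ℤ; 0ℤ; 1ℤ; -1ℤ) renaming (_+_ to _+ℤ_; _*_ to _*ℤ_; -_ to -ℤ_; _^_ to _^ℤ_)
import Data.Integer.Properties as ℤP
open import Data.List using ([]; _∷_; replicate; _++_)
open import Data.Maybe using (Maybe; just; nothing)
open import Data.Product using (Σ; ∃; _×_; _,_; proj₂)
open import Data.Sum using (_⊎_; inj₁; inj₂; [_,_])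
open import Data.Empty using (⊥-elim)
open import Relation.Nullary using (¬_; yes; no)
open import Relation.Binary.PropositionalEquality hiding ([_])
open import Relation.Binary.Definitions using (tri<; tri≈; tri>)
open import Relation.Binary.Bundles using (Setoid)
open import Algebra.Bundles using (CommutativeRing)
import Tactic.RingSolver.Core.AlmostCommutativeRing as ACR
open import Tactic.RingSolver using (solve-∀)
import Data.Integer.Tactic.RingSolver as ℤSolver
open import Function using (_∘_)

coeff-+ₚ : ∀ p q i → coeff (p +ₚ q) i ≡ coeff p i +ℤ coeff q i
coeff-+ₚ []      q       i       = sym (ℤP.+-identityˡ _)
coeff-+ₚ (a ∷ p) []      i       = sym (ℤP.+-identityʳ _)
coeff-+ₚ (a ∷ p) (b ∷ q) zero    = refl
coeff-+ₚ (a ∷ p) (b ∷ q) (suc i) = coeff-+ₚ p q i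

coeff-·ₚ : ∀ c p i → coeff (c ·ₚ p) i ≡ c *ℤ coeff p i
coeff-·ₚ c []      i       = sym (ℤP.*-zeroʳ c)
coeff-·ₚ c (a ∷ p) zero    = refl
coeff-·ₚ c (a ∷ p) (suc i) = coeff-·ₚ c p i

coeff-*ₚ : ∀ a p q i → coeff ((a ∷ p) *ₚ q) i ≡ a *ℤ coeff q i +ℤ coeff (0ℤ ∷ (p *ₚ q)) i
coeff-*ₚ a p q i = trans (coeff-+ₚ (a ·ₚ q) _ i) (cong (_+ℤ _) (coeff-·ₚ a q i))

-- A record around _≈ₚ_, so that both polynomials can be inferred from a proof.
infix 4 _≋_
record _≋_ (p q : Poly) : Set where
  constructor coeffwise
  field coeff-≡ : p ≈ₚ q
open _≋_ public

≋-setoid : Setoid _ _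
≋-setoid = record
  { Carrier = Poly ; _≈_ = _≋_
  ; isEquivalence = record
    { refl  = coeffwise λ i → refl
    ; sym   = λ (coeffwise e) → coeffwise λ i → sym (e i)
    ; trans = λ (coeffwise e) (coeffwise f) → coeffwise λ i → trans (e i) (f i)
    }
  }

open Setoid ≋-setoid public using () renaming (refl to ≋-refl; sym to ≋-sym; trans to ≋-trans)

VanishesOn : (ℕ → Set) → Poly → Set
VanishesOn Z p = ∀ i → Z i → coeff p i ≡ 0ℤ

vanishesOn-cong : ∀ {Z p q} → p ≋ q → VanishesOn Z p → VanishesOn Z q
vanishesOn-cong (coeffwise p≈q) p-vanishes i zᵢ = trans (sym (p≈q i)) (p-vanishes i zᵢ)

+ₚ-vanishesOn : ∀ {Z} p q → VanishesOn Z p → VanishesOn Z q → VanishesOn Z (p +ₚ q)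
+ₚ-vanishesOn p q p-vanishes q-vanishes i zᵢ =
  trans (coeff-+ₚ p q i) (cong₂ _+ℤ_ (p-vanishes i zᵢ) (q-vanishes i zᵢ))

·ₚ-vanishesOn : ∀ {Z} c p → VanishesOn Z p → VanishesOn Z (c ·ₚ p)
·ₚ-vanishesOn c p p-vanishes i zᵢ =
  trans (coeff-·ₚ c p i) (trans (cong (c *ℤ_) (p-vanishes i zᵢ)) (ℤP.*-zeroʳ c))

∷-cong : ∀ {a b p q} → a ≡ b → p ≋ q → (a ∷ p) ≋ (b ∷ q)
∷-cong a≡b (coeffwise p≈q) = coeffwise λ { zero → a≡b ; (suc i) → p≈q i }

∷-tail : ∀ {a b p q} → (a ∷ p) ≋ (b ∷ q) → p ≋ q
∷-tail (coeffwise e) = coeffwise λ i → e (suc i)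

0∷-zero : ∀ {p} → p ≋ 0ₚ → (0ℤ ∷ p) ≋ 0ₚ
0∷-zero (coeffwise p≈0) = coeffwise λ { zero → refl ; (suc i) → p≈0 i }

+ₚ-cong : ∀ {p p′ q q′} → p ≋ p′ → q ≋ q′ → (p +ₚ q) ≋ (p′ +ₚ q′)
+ₚ-cong {p} {p′} {q} {q′} (coeffwise e) (coeffwise f) = coeffwise λ i →
  trans (coeff-+ₚ p q i) (trans (cong₂ _+ℤ_ (e i) (f i)) (sym (coeff-+ₚ p′ q′ i)))

·ₚ-congʳ : ∀ c {p p′} → p ≋ p′ → (c ·ₚ p) ≋ (c ·ₚ p′)
·ₚ-congʳ c {p} {p′} (coeffwise e) = coeffwise λ i →
  trans (coeff-·ₚ c p i) (trans (cong (c *ℤ_) (e i)) (sym (coeff-·ₚ c p′ i)))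

+ₚ-comm : ∀ p q → (p +ₚ q) ≋ (q +ₚ p)
+ₚ-comm p q = coeffwise λ i →
  trans (coeff-+ₚ p q i) (trans (ℤP.+-comm (coeff p i) _) (sym (coeff-+ₚ q p i)))

+ₚ-assoc : ∀ p q r → ((p +ₚ q) +ₚ r) ≋ (p +ₚ (q +ₚ r))
+ₚ-assoc p q r = coeffwise λ i → begin
  coeff ((p +ₚ q) +ₚ r) i                 ≡⟨ coeff-+ₚ (p +ₚ q) r i ⟩
  coeff (p +ₚ q) i +ℤ coeff r i           ≡⟨ cong (_+ℤ coeff r i) (coeff-+ₚ p q i) ⟩
  (coeff p i +ℤ coeff q i) +ℤ coeff r i   ≡⟨ ℤP.+-assoc (coeff p i) _ _ ⟩
  coeff p i +ℤ (coeff q i +ℤ coeff r i)   ≡⟨ cong (coeff p i +ℤ_) (coeff-+ₚ q r i) ⟨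
  coeff p i +ℤ coeff (q +ₚ r) i           ≡⟨ coeff-+ₚ p (q +ₚ r) i ⟨
  coeff (p +ₚ (q +ₚ r)) i                 ∎
  where open ≡-Reasoning

+ₚ-identityʳ : ∀ p → (p +ₚ 0ₚ) ≋ p
+ₚ-identityʳ []      = ≋-refl
+ₚ-identityʳ (a ∷ p) = ≋-refl

-ₚ_ : Poly → Poly
-ₚ p = -1ℤ ·ₚ p

coeff-−ₚ : ∀ p q i → coeff (p +ₚ (-ₚ q)) i ≡ coeff p i +ℤ -ℤ coeff q i
coeff-−ₚ p q i = trans (coeff-+ₚ p (-ₚ q) i) (cong (coeff p i +ℤ_) (trans (coeff-·ₚ -1ℤ q i) (ℤP.-1*i≡-i _)))

-ₚ‿inverseʳ : ∀ p → (p +ₚ (-ₚ p)) ≋ 0ₚ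
-ₚ‿inverseʳ p = coeffwise λ i → trans (coeff-−ₚ p p i) (ℤP.+-inverseʳ (coeff p i))

·ₚ-distribˡ : ∀ c p q → (c ·ₚ (p +ₚ q)) ≋ ((c ·ₚ p) +ₚ (c ·ₚ q))
·ₚ-distribˡ c p q = coeffwise λ i → begin
  coeff (c ·ₚ (p +ₚ q)) i                       ≡⟨ coeff-·ₚ c (p +ₚ q) i ⟩
  c *ℤ coeff (p +ₚ q) i                         ≡⟨ cong (c *ℤ_) (coeff-+ₚ p q i) ⟩
  c *ℤ (coeff p i +ℤ coeff q i)                 ≡⟨ ℤP.*-distribˡ-+ c _ _ ⟩
  c *ℤ coeff p i +ℤ c *ℤ coeff q i              ≡⟨ cong₂ _+ℤ_ (coeff-·ₚ c p i) (coeff-·ₚ c q i) ⟨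
  coeff (c ·ₚ p) i +ℤ coeff (c ·ₚ q) i          ≡⟨ coeff-+ₚ (c ·ₚ p) (c ·ₚ q) i ⟨
  coeff ((c ·ₚ p) +ₚ (c ·ₚ q)) i                ∎
  where open ≡-Reasoning

·ₚ-distribʳ : ∀ c d p → ((c +ℤ d) ·ₚ p) ≋ ((c ·ₚ p) +ₚ (d ·ₚ p))
·ₚ-distribʳ c d p = coeffwise λ i → begin
  coeff ((c +ℤ d) ·ₚ p) i                       ≡⟨ coeff-·ₚ (c +ℤ d) p i ⟩
  (c +ℤ d) *ℤ coeff p i                         ≡⟨ ℤP.*-distribʳ-+ (coeff p i) c d ⟩
  c *ℤ coeff p i +ℤ d *ℤ coeff p i              ≡⟨ cong₂ _+ℤ_ (coeff-·ₚ c p i) (coeff-·ₚ d p i) ⟨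
  coeff (c ·ₚ p) i +ℤ coeff (d ·ₚ p) i          ≡⟨ coeff-+ₚ (c ·ₚ p) (d ·ₚ p) i ⟨
  coeff ((c ·ₚ p) +ₚ (d ·ₚ p)) i                ∎
  where open ≡-Reasoning

·ₚ-assoc : ∀ c d p → ((c *ℤ d) ·ₚ p) ≋ (c ·ₚ (d ·ₚ p))
·ₚ-assoc c d p = coeffwise λ i → begin
  coeff ((c *ℤ d) ·ₚ p) i     ≡⟨ coeff-·ₚ (c *ℤ d) p i ⟩
  (c *ℤ d) *ℤ coeff p i       ≡⟨ ℤP.*-assoc c d _ ⟩
  c *ℤ (d *ℤ coeff p i)       ≡⟨ cong (c *ℤ_) (coeff-·ₚ d p i) ⟨
  c *ℤ coeff (d ·ₚ p) i       ≡⟨ coeff-·ₚ c (d ·ₚ p) i ⟨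
  coeff (c ·ₚ (d ·ₚ p)) i     ∎
  where open ≡-Reasoning

·ₚ-zeroˡ : ∀ p → (0ℤ ·ₚ p) ≋ 0ₚ
·ₚ-zeroˡ p = coeffwise (coeff-·ₚ 0ℤ p)

·ₚ-identityˡ : ∀ p → (1ℤ ·ₚ p) ≋ p
·ₚ-identityˡ p = coeffwise λ i → trans (coeff-·ₚ 1ℤ p i) (ℤP.*-identityˡ _)

+ₚ-swap : ∀ p q r → (p +ₚ (q +ₚ r)) ≋ (q +ₚ (p +ₚ r))
+ₚ-swap p q r = begin
  p +ₚ (q +ₚ r)   ≈⟨ +ₚ-assoc p q r ⟨
  (p +ₚ q) +ₚ r   ≈⟨ +ₚ-cong (+ₚ-comm p q) (≋-refl {r}) ⟩
  (q +ₚ p) +ₚ r   ≈⟨ +ₚ-assoc q p r ⟩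
  q +ₚ (p +ₚ r)   ∎
  where open import Relation.Binary.Reasoning.Setoid ≋-setoid

+ₚ-interchange : ∀ p q r s → ((p +ₚ q) +ₚ (r +ₚ s)) ≋ ((p +ₚ r) +ₚ (q +ₚ s))
+ₚ-interchange p q r s = begin
  (p +ₚ q) +ₚ (r +ₚ s)   ≈⟨ +ₚ-assoc p q (r +ₚ s) ⟩
  p +ₚ (q +ₚ (r +ₚ s))   ≈⟨ +ₚ-cong (≋-refl {p}) (+ₚ-swap q r s) ⟩
  p +ₚ (r +ₚ (q +ₚ s))   ≈⟨ +ₚ-assoc p r (q +ₚ s) ⟨
  (p +ₚ r) +ₚ (q +ₚ s)   ∎
  where open import Relation.Binary.Reasoning.Setoid ≋-setoid

·ₚ-congˡ : ∀ {c d} p → c ≡ d → (c ·ₚ p) ≋ (d ·ₚ p)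
·ₚ-congˡ p refl = ≋-refl

*ₚ-zeroˡ-≋ : ∀ p q → p ≋ 0ₚ → (p *ₚ q) ≋ 0ₚ
*ₚ-zeroˡ-≋ []      q _             = ≋-refl
*ₚ-zeroˡ-≋ (a ∷ p) q (coeffwise e) =
  +ₚ-cong (≋-trans (·ₚ-congˡ q (e 0)) (·ₚ-zeroˡ q)) (0∷-zero (*ₚ-zeroˡ-≋ p q (coeffwise λ i → e (suc i))))

*ₚ-zeroʳ : ∀ p → (p *ₚ 0ₚ) ≋ 0ₚ
*ₚ-zeroʳ []      = ≋-refl
*ₚ-zeroʳ (a ∷ p) = 0∷-zero (*ₚ-zeroʳ p)

*ₚ-congʳ : ∀ q {p p′} → p ≋ p′ → (p *ₚ q) ≋ (p′ *ₚ q)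
*ₚ-congʳ q {[]}    {p′}     e = ≋-sym (*ₚ-zeroˡ-≋ p′ q (≋-sym e))
*ₚ-congʳ q {a ∷ p} {[]}     e = *ₚ-zeroˡ-≋ (a ∷ p) q e
*ₚ-congʳ q {a ∷ p} {b ∷ p′} e =
  +ₚ-cong (·ₚ-congˡ q (coeff-≡ e 0)) (∷-cong refl (*ₚ-congʳ q (∷-tail e)))

*ₚ-congˡ : ∀ p {q q′} → q ≋ q′ → (p *ₚ q) ≋ (p *ₚ q′)
*ₚ-congˡ []      e = ≋-refl
*ₚ-congˡ (a ∷ p) e = +ₚ-cong (·ₚ-congʳ a e) (∷-cong refl (*ₚ-congˡ p e))

*ₚ-cong : ∀ {p p′ q q′} → p ≋ p′ → q ≋ q′ → (p *ₚ q) ≋ (p′ *ₚ q′)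
*ₚ-cong {p′ = p′} {q = q} e f = ≋-trans (*ₚ-congʳ q e) (*ₚ-congˡ p′ f)

*ₚ-∷ʳ : ∀ p b q → (p *ₚ (b ∷ q)) ≋ ((b ·ₚ p) +ₚ (0ℤ ∷ (p *ₚ q)))
*ₚ-∷ʳ []      b q = ≋-sym (0∷-zero ≋-refl)
*ₚ-∷ʳ (a ∷ p) b q = ∷-cong (cong (_+ℤ 0ℤ) (ℤP.*-comm a b))
  (≋-trans (+ₚ-cong (≋-refl {a ·ₚ q}) (*ₚ-∷ʳ p b q)) (+ₚ-swap (a ·ₚ q) (b ·ₚ p) _))

*ₚ-comm : ∀ p q → (p *ₚ q) ≋ (q *ₚ p)
*ₚ-comm []      q = ≋-sym (*ₚ-zeroʳ q)
*ₚ-comm (a ∷ p) q =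
  ≋-trans (+ₚ-cong (≋-refl {a ·ₚ q}) (∷-cong refl (*ₚ-comm p q))) (≋-sym (*ₚ-∷ʳ q a p))

*ₚ-distribʳ : ∀ r p q → ((p +ₚ q) *ₚ r) ≋ ((p *ₚ r) +ₚ (q *ₚ r))
*ₚ-distribʳ r []      q       = ≋-refl
*ₚ-distribʳ r (a ∷ p) []      = ≋-sym (+ₚ-identityʳ _)
*ₚ-distribʳ r (a ∷ p) (b ∷ q) =
  ≋-trans (+ₚ-cong (·ₚ-distribʳ a b r) (∷-cong refl (*ₚ-distribʳ r p q)))
          (+ₚ-interchange (a ·ₚ r) (b ·ₚ r) _ _)

*ₚ-distribˡ : ∀ p q r → (p *ₚ (q +ₚ r)) ≋ ((p *ₚ q) +ₚ (p *ₚ r))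
*ₚ-distribˡ []      q r = ≋-refl
*ₚ-distribˡ (a ∷ p) q r =
  ≋-trans (+ₚ-cong (·ₚ-distribˡ a q r) (∷-cong refl (*ₚ-distribˡ p q r)))
          (+ₚ-interchange (a ·ₚ q) (a ·ₚ r) _ _)

·ₚ-*ₚ-assoc : ∀ c q r → ((c ·ₚ q) *ₚ r) ≋ (c ·ₚ (q *ₚ r))
·ₚ-*ₚ-assoc c []      r = ≋-refl
·ₚ-*ₚ-assoc c (a ∷ q) r =
  ≋-trans (+ₚ-cong (·ₚ-assoc c a r) (∷-cong (sym (ℤP.*-zeroʳ c)) (·ₚ-*ₚ-assoc c q r)))
          (≋-sym (·ₚ-distribˡ c (a ·ₚ r) _))

*ₚ-assoc : ∀ p q r → ((p *ₚ q) *ₚ r) ≋ (p *ₚ (q *ₚ r))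
*ₚ-assoc []      q r = ≋-refl
*ₚ-assoc (a ∷ p) q r =
  ≋-trans (*ₚ-distribʳ r (a ·ₚ q) _)
          (+ₚ-cong (·ₚ-*ₚ-assoc a q r) (+ₚ-cong (·ₚ-zeroˡ r) (∷-cong refl (*ₚ-assoc p q r))))

*ₚ-identityˡ : ∀ p → (1ₚ *ₚ p) ≋ p
*ₚ-identityˡ p = ≋-trans (+ₚ-cong (·ₚ-identityˡ p) (0∷-zero ≋-refl)) (+ₚ-identityʳ p)

ℤ[x] : CommutativeRing _ _
ℤ[x] = record
  { Carrier = Poly ; _≈_ = _≋_ ; _+_ = _+ₚ_ ; _*_ = _*ₚ_ ; -_ = -ₚ_ ; 0# = 0ₚ ; 1# = 1ₚ
  ; isCommutativeRing = record
    { isRing = record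
      { +-isAbelianGroup = record
        { isGroup = record
          { isMonoid = record
            { isSemigroup = record
              { isMagma = record { isEquivalence = Setoid.isEquivalence ≋-setoid ; ∙-cong = +ₚ-cong }
              ; assoc = +ₚ-assoc }
            ; identity = (λ p → ≋-refl) , +ₚ-identityʳ }
          ; inverse = (λ p → ≋-trans (+ₚ-comm (-ₚ p) p) (-ₚ‿inverseʳ p)) , -ₚ‿inverseʳ
          ; ⁻¹-cong = ·ₚ-congʳ -1ℤ }
        ; comm = +ₚ-comm }
      ; *-cong = *ₚ-cong
      ; *-assoc = *ₚ-assoc
      ; *-identity = *ₚ-identityˡ , (λ p → ≋-trans (*ₚ-comm p 1ₚ) (*ₚ-identityˡ p))
      ; distrib = *ₚ-distribˡ , *ₚ-distribʳ }
    ; *-comm = *ₚ-comm } }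

ℤ[x]-solver : ACR.AlmostCommutativeRing _ _
ℤ[x]-solver = ACR.fromCommutativeRing ℤ[x] zero?
  where
  -- the solver needs a genuine zero test to discard cancelled monomials
  zero? : ∀ p → Maybe (0ₚ ≋ p)
  zero? []      = just ≋-refl
  zero? (a ∷ p) with a ℤ.≟ 0ℤ | zero? p
  ... | yes refl | just 0≋p = just (≋-sym (0∷-zero (≋-sym 0≋p)))
  ... | _        | _        = nothing

*-≢0 : ∀ {x y : ℤ} → x ≢ 0ℤ → y ≢ 0ℤ → x *ℤ y ≢ 0ℤ
*-≢0 {x} x≢0 y≢0 xy≡0 = [ x≢0 , y≢0 ] (ℤP.i*j≡0⇒i≡0∨j≡0 x xy≡0)

^-≢0 : ∀ {x : ℤ} n → x ≢ 0ℤ → x ^ℤ n ≢ 0ℤ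
^-≢0 zero    x≢0 ()
^-≢0 (suc n) x≢0 = *-≢0 x≢0 (^-≢0 n x≢0)

eval0-*ₚ : ∀ p q → eval0 (p *ₚ q) ≡ eval0 p *ℤ eval0 q
eval0-*ₚ []      q = refl
eval0-*ₚ (a ∷ p) q = trans (coeff-*ₚ a p q 0) (ℤP.+-identityʳ _)

eval0-^ₚ : ∀ p n → eval0 (p ^ₚ n) ≡ eval0 p ^ℤ n
eval0-^ₚ p zero    = refl
eval0-^ₚ p (suc n) = trans (eval0-*ₚ p (p ^ₚ n)) (cong (eval0 p *ℤ_) (eval0-^ₚ p n))

VanishesBelow : ℕ → Poly → Set
VanishesBelow j = VanishesOn (_< j)

infix 4 _hasOrder_
record _hasOrder_ (p : Poly) (j : ℕ) : Set where
  constructor order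
  field
    vanishesBelow : VanishesBelow j p
    coeff≢0       : coeff p j ≢ 0ℤ
open _hasOrder_ public

hasOrder-0 : ∀ {p} → eval0 p ≢ 0ℤ → p hasOrder 0
hasOrder-0 p₀≢0 = order (λ _ ()) p₀≢0

hasOrder-cong : ∀ {p q j} → p ≋ q → p hasOrder j → q hasOrder j
hasOrder-cong {j = j} p≋q@(coeffwise p≈q) (order below p≢0) =
  order (vanishesOn-cong p≋q below) (λ q≡0 → p≢0 (trans (p≈q j) q≡0))

hasOrder-unique : ∀ {p i j} → p hasOrder i → p hasOrder j → i ≡ j
hasOrder-unique {i = i} {j} (order belowᵢ pᵢ≢0) (order belowⱼ pⱼ≢0) with ℕP.<-cmp i j
... | tri< i<j _ _ = ⊥-elim (pᵢ≢0 (belowⱼ i i<j))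
... | tri≈ _ i≡j _ = i≡j
... | tri> _ _ j<i = ⊥-elim (pⱼ≢0 (belowᵢ j j<i))

0∷-vanishesBelow : ∀ {p j} → VanishesBelow j p → VanishesBelow (suc j) (0ℤ ∷ p)
0∷-vanishesBelow below zero    _         = refl
0∷-vanishesBelow below (suc l) (s≤s l<j) = below l l<j

0∷-hasOrder : ∀ {p j} → p hasOrder j → (0ℤ ∷ p) hasOrder suc j
0∷-hasOrder (order below p≢0) = order (0∷-vanishesBelow below) p≢0

zero-or-hasOrder : ∀ p → p ≋ 0ₚ ⊎ ∃ (p hasOrder_)
zero-or-hasOrder []      = inj₁ ≋-refl
zero-or-hasOrder (a ∷ p) with a ℤ.≟ 0ℤ
... | no a≢0   = inj₂ (0 , hasOrder-0 a≢0)
... | yes refl with zero-or-hasOrder p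
...   | inj₁ p≈0       = inj₁ (0∷-zero p≈0)
...   | inj₂ (j , ord) = inj₂ (suc j , 0∷-hasOrder ord)

*ₚ-vanishesBelow : ∀ p q {j} → VanishesBelow j q → VanishesBelow j (p *ₚ q)
*ₚ-vanishesBelow []      q below l l<j = refl
*ₚ-vanishesBelow (a ∷ p) q below l l<j = begin
  coeff ((a ∷ p) *ₚ q) l                       ≡⟨ coeff-*ₚ a p q l ⟩
  a *ℤ coeff q l +ℤ coeff (0ℤ ∷ (p *ₚ q)) l    ≡⟨ cong₂ _+ℤ_ (cong (a *ℤ_) (below l l<j)) shifted ⟩
  a *ℤ 0ℤ +ℤ 0ℤ                                ≡⟨ cong (_+ℤ 0ℤ) (ℤP.*-zeroʳ a) ⟩
  0ℤ                                           ∎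
  where
  open ≡-Reasoning
  shifted : coeff (0ℤ ∷ (p *ₚ q)) l ≡ 0ℤ
  shifted = 0∷-vanishesBelow (*ₚ-vanishesBelow p q below) l (ℕP.m<n⇒m<1+n l<j)

*ₚ-hasOrder : ∀ {p q} i {j} → p hasOrder i → q hasOrder j → (p *ₚ q) hasOrder (i + j)
*ₚ-hasOrder {[]}    i       (order _ p≢0) _ = ⊥-elim (p≢0 refl)
*ₚ-hasOrder {a ∷ p} {q} zero {j} (order _ a≢0) (order below qⱼ≢0) =
  order (*ₚ-vanishesBelow (a ∷ p) q below) λ coeffⱼ≡0 → *-≢0 a≢0 qⱼ≢0 (begin
    a *ℤ coeff q j                             ≡⟨ ℤP.+-identityʳ _ ⟨
    a *ℤ coeff q j +ℤ 0ℤ                       ≡⟨ cong (a *ℤ coeff q j +ℤ_) shifted ⟨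
    a *ℤ coeff q j +ℤ coeff (0ℤ ∷ (p *ₚ q)) j  ≡⟨ coeff-*ₚ a p q j ⟨
    coeff ((a ∷ p) *ₚ q) j                     ≡⟨ coeffⱼ≡0 ⟩
    0ℤ                                         ∎)
  where
  open ≡-Reasoning
  shifted : coeff (0ℤ ∷ (p *ₚ q)) j ≡ 0ℤ
  shifted = 0∷-vanishesBelow (*ₚ-vanishesBelow p q below) j (ℕP.n<1+n j)
*ₚ-hasOrder {a ∷ p} {q} (suc i) (order below p≢0) ordq with below 0 (s≤s z≤n)
... | refl = hasOrder-cong (+ₚ-cong (≋-sym (·ₚ-zeroˡ q)) ≋-refl)
               (0∷-hasOrder (*ₚ-hasOrder {p} i (order (λ l l<i → below (suc l) (s≤s l<i)) p≢0) ordq))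

^ₚ-≢0 : ∀ p n → eval0 p ≢ 0ℤ → eval0 (p ^ₚ n) ≢ 0ℤ
^ₚ-≢0 p n p₀≢0 = ^-≢0 n p₀≢0 ∘ trans (sym (eval0-^ₚ p n))

≉0⇒hasOrder : ∀ {p} → ¬ (p ≋ 0ₚ) → ∃ (p hasOrder_)
≉0⇒hasOrder {p} p≉0 with zero-or-hasOrder p
... | inj₁ p≈0 = ⊥-elim (p≉0 p≈0)
... | inj₂ ord = ord

^ₚ-distrib-*ₚ : ∀ p q n → ((p *ₚ q) ^ₚ n) ≋ ((p ^ₚ n) *ₚ (q ^ₚ n))
^ₚ-distrib-*ₚ p q zero    = ≋-sym (*ₚ-identityˡ 1ₚ)
^ₚ-distrib-*ₚ p q (suc n) = ≋-trans (*ₚ-congˡ (p *ₚ q) (^ₚ-distrib-*ₚ p q n)) (interchange p q _ _)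
  where
  interchange : ∀ p q r s → ((p *ₚ q) *ₚ (r *ₚ s)) ≋ ((p *ₚ r) *ₚ (q *ₚ s))
  interchange = solve-∀ ℤ[x]-solver

geomSum : Poly → Poly → ℕ → Poly
geomSum X Y zero    = 0ₚ
geomSum X Y (suc j) = (X *ₚ geomSum X Y j) +ₚ (Y ^ₚ j)

^ₚ-via-geomSum : ∀ X Y j → (X ^ₚ j) ≋ ((Y ^ₚ j) +ₚ ((X +ₚ (-ₚ Y)) *ₚ geomSum X Y j))
^ₚ-via-geomSum X Y zero    = ≋-sym (≋-trans (+ₚ-cong (≋-refl {1ₚ}) (*ₚ-zeroʳ (X +ₚ (-ₚ Y)))) (+ₚ-identityʳ 1ₚ))
^ₚ-via-geomSum X Y (suc j) = ≋-trans (*ₚ-congˡ X (^ₚ-via-geomSum X Y j)) (step X Y (Y ^ₚ j) (geomSum X Y j))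
  where
  step : ∀ X Y W S → (X *ₚ (W +ₚ ((X +ₚ (-ₚ Y)) *ₚ S)))
                     ≋ ((Y *ₚ W) +ₚ ((X +ₚ (-ₚ Y)) *ₚ ((X *ₚ S) +ₚ W)))
  step = solve-∀ ℤ[x]-solver

eval0-geomSum : ∀ X Y {c} j → eval0 X ≡ c → eval0 Y ≡ c
                → eval0 (geomSum X Y (suc j)) ≡ ℤ.+ suc j *ℤ c ^ℤ j
eval0-geomSum X Y zero _ _ = begin
  eval0 ((X *ₚ 0ₚ) +ₚ 1ₚ)       ≡⟨ coeff-+ₚ (X *ₚ 0ₚ) 1ₚ 0 ⟩
  eval0 (X *ₚ 0ₚ) +ℤ 1ℤ         ≡⟨ cong (_+ℤ 1ℤ) (coeff-≡ (*ₚ-zeroʳ X) 0) ⟩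
  1ℤ                            ∎
  where open ≡-Reasoning
eval0-geomSum X Y {c} (suc j) X₀≡c Y₀≡c = begin
  eval0 ((X *ₚ S) +ₚ (Y ^ₚ suc j))                  ≡⟨ coeff-+ₚ (X *ₚ S) (Y ^ₚ suc j) 0 ⟩
  eval0 (X *ₚ S) +ℤ eval0 (Y ^ₚ suc j)              ≡⟨ cong₂ _+ℤ_ (eval0-*ₚ X S) (eval0-^ₚ Y (suc j)) ⟩
  eval0 X *ℤ eval0 S +ℤ eval0 Y ^ℤ suc j            ≡⟨ cong₂ (λ x y → x *ℤ eval0 S +ℤ y ^ℤ suc j) X₀≡c Y₀≡c ⟩
  c *ℤ eval0 S +ℤ c ^ℤ suc j                        ≡⟨ cong (λ s → c *ℤ s +ℤ c ^ℤ suc j) (eval0-geomSum X Y j X₀≡c Y₀≡c) ⟩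
  c *ℤ (ℤ.+ suc j *ℤ c ^ℤ j) +ℤ c *ℤ c ^ℤ j         ≡⟨ regroup c (c ^ℤ j) (ℤ.+ suc j) ⟩
  ℤ.+ suc (suc j) *ℤ c ^ℤ suc j                     ∎
  where
  open ≡-Reasoning
  S : Poly
  S = geomSum X Y (suc j)
  regroup : ∀ c t z → c *ℤ (z *ℤ t) +ℤ c *ℤ t ≡ (1ℤ +ℤ z) *ℤ (c *ℤ t)
  regroup = ℤSolver.solve-∀

^ₚ-cross-multiply : ∀ a b A B G₁ G₂ n → ((a ^ₚ n) *ₚ G₂) ≋ (G₁ *ₚ (b ^ₚ n))
                    → (((a *ₚ B) ^ₚ n) *ₚ (G₂ *ₚ (A ^ₚ n))) ≋ (((A *ₚ b) ^ₚ n) *ₚ (G₁ *ₚ (B ^ₚ n)))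
^ₚ-cross-multiply a b A B G₁ G₂ n hyp = begin
  ((a *ₚ B) ^ₚ n) *ₚ (G₂ *ₚ (A ^ₚ n))            ≈⟨ *ₚ-congʳ _ (^ₚ-distrib-*ₚ a B n) ⟩
  ((a ^ₚ n) *ₚ (B ^ₚ n)) *ₚ (G₂ *ₚ (A ^ₚ n))     ≈⟨ regroup (a ^ₚ n) (B ^ₚ n) G₂ (A ^ₚ n) ⟩
  ((a ^ₚ n) *ₚ G₂) *ₚ ((A ^ₚ n) *ₚ (B ^ₚ n))     ≈⟨ *ₚ-congʳ _ hyp ⟩
  (G₁ *ₚ (b ^ₚ n)) *ₚ ((A ^ₚ n) *ₚ (B ^ₚ n))     ≈⟨ regroup′ G₁ (b ^ₚ n) (A ^ₚ n) (B ^ₚ n) ⟩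
  ((A ^ₚ n) *ₚ (b ^ₚ n)) *ₚ (G₁ *ₚ (B ^ₚ n))     ≈⟨ *ₚ-congʳ _ (^ₚ-distrib-*ₚ A b n) ⟨
  ((A *ₚ b) ^ₚ n) *ₚ (G₁ *ₚ (B ^ₚ n))            ∎
  where
  regroup : ∀ x y z w → ((x *ₚ y) *ₚ (z *ₚ w)) ≋ ((x *ₚ z) *ₚ (w *ₚ y))
  regroup = solve-∀ ℤ[x]-solver
  regroup′ : ∀ x y z w → ((x *ₚ y) *ₚ (z *ₚ w)) ≋ ((z *ₚ y) *ₚ (x *ₚ w))
  regroup′ = solve-∀ ℤ[x]-solver
  open import Relation.Binary.Reasoning.Setoid ≋-setoid

^ₚ-difference-factor : ∀ X Y H₁ H₂ n → ((X ^ₚ n) *ₚ H₂) ≋ ((Y ^ₚ n) *ₚ H₁)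
                       → ((Y ^ₚ n) *ₚ (H₁ +ₚ (-ₚ H₂))) ≋ ((X +ₚ (-ₚ Y)) *ₚ (geomSum X Y n *ₚ H₂))
^ₚ-difference-factor X Y H₁ H₂ n hyp = begin
  (Y ^ₚ n) *ₚ (H₁ +ₚ (-ₚ H₂))                                  ≈⟨ distrib (Y ^ₚ n) H₁ H₂ ⟩
  ((Y ^ₚ n) *ₚ H₁) +ₚ (-ₚ ((Y ^ₚ n) *ₚ H₂))                     ≈⟨ +ₚ-cong (≋-sym hyp) ≋-refl ⟩
  ((X ^ₚ n) *ₚ H₂) +ₚ (-ₚ ((Y ^ₚ n) *ₚ H₂))                     ≈⟨ +ₚ-cong (*ₚ-congʳ H₂ (^ₚ-via-geomSum X Y n)) ≋-refl ⟩
  (((Y ^ₚ n) +ₚ ((X +ₚ (-ₚ Y)) *ₚ S)) *ₚ H₂) +ₚ (-ₚ ((Y ^ₚ n) *ₚ H₂))  ≈⟨ cancel (Y ^ₚ n) (X +ₚ (-ₚ Y)) S H₂ ⟩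
  (X +ₚ (-ₚ Y)) *ₚ (S *ₚ H₂)                                   ∎
  where
  S : Poly
  S = geomSum X Y n
  distrib : ∀ x y z → (x *ₚ (y +ₚ (-ₚ z))) ≋ ((x *ₚ y) +ₚ (-ₚ (x *ₚ z)))
  distrib = solve-∀ ℤ[x]-solver
  cancel : ∀ w u s h → (((w +ₚ (u *ₚ s)) *ₚ h) +ₚ (-ₚ (w *ₚ h))) ≋ (u *ₚ (s *ₚ h))
  cancel = solve-∀ ℤ[x]-solver
  open import Relation.Binary.Reasoning.Setoid ≋-setoid

module Residues (m : ℕ) where

  k : ℕ
  k = suc m

  -- xˢ p lies in ℤ[xᵏ]
  Concentrated : ℕ → Poly → Set
  Concentrated s = VanishesOn (λ i → ¬ k ∣ s + i)

  -- xˢ p has no monomial whose degree is a multiple of k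
  Avoiding : ℕ → Poly → Set
  Avoiding s = VanishesOn (λ i → k ∣ s + i)

  ∣-+-suc : ∀ s i → k ∣ s + suc i → k ∣ suc (s + i)
  ∣-+-suc s i = subst (k ∣_) (ℕP.+-suc s i)

  ∣-suc-+ : ∀ s i → k ∣ suc (s + i) → k ∣ s + suc i
  ∣-suc-+ s i = subst (k ∣_) (sym (ℕP.+-suc s i))

  concentrated-head : ∀ {s a p} → Concentrated s (a ∷ p) → ¬ k ∣ s → a ≡ 0ℤ
  concentrated-head {s} conc k∤s = conc 0 (k∤s ∘ subst (k ∣_) (ℕP.+-identityʳ s))

  concentrated-tail : ∀ {s a p} → Concentrated s (a ∷ p) → Concentrated (suc s) p
  concentrated-tail {s} conc i k∤ = conc (suc i) (k∤ ∘ ∣-+-suc s i)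

  *ₚ-concentrated : ∀ {s t} P Q → Concentrated s P → Concentrated t Q → Concentrated (s + t) (P *ₚ Q)
  *ₚ-concentrated []      Q _ _ i _ = refl
  *ₚ-concentrated {s} {t} (a ∷ P) Q P-conc Q-conc i k∤ = begin
    coeff ((a ∷ P) *ₚ Q) i                       ≡⟨ coeff-*ₚ a P Q i ⟩
    a *ℤ coeff Q i +ℤ coeff (0ℤ ∷ (P *ₚ Q)) i    ≡⟨ cong₂ _+ℤ_ head-term (shifted i k∤) ⟩
    0ℤ                                           ∎
    where
    open ≡-Reasoning
    head-term : a *ℤ coeff Q i ≡ 0ℤ
    head-term with k ∣? s
    ... | yes k∣s = trans (cong (a *ℤ_) (Q-conc i λ k∣t+i →
                      k∤ (subst (k ∣_) (sym (ℕP.+-assoc s t i)) (∣m∣n⇒∣m+n k∣s k∣t+i))))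
                    (ℤP.*-zeroʳ a)
    ... | no  k∤s = cong (_*ℤ coeff Q i) (concentrated-head P-conc k∤s)
    shifted : Concentrated (s + t) (0ℤ ∷ (P *ₚ Q))
    shifted zero    _  = refl
    shifted (suc i) k∤ = *ₚ-concentrated P Q (concentrated-tail P-conc) Q-conc i (k∤ ∘ ∣-suc-+ (s + t) i)

  *ₚ-concentrated-avoiding : ∀ {s t} P Q → Concentrated s P → Avoiding t Q → Avoiding (s + t) (P *ₚ Q)
  *ₚ-concentrated-avoiding []      Q _ _ i _ = refl
  *ₚ-concentrated-avoiding {s} {t} (a ∷ P) Q P-conc Q-av i k∣ = begin
    coeff ((a ∷ P) *ₚ Q) i                       ≡⟨ coeff-*ₚ a P Q i ⟩
    a *ℤ coeff Q i +ℤ coeff (0ℤ ∷ (P *ₚ Q)) i    ≡⟨ cong₂ _+ℤ_ head-term (shifted i k∣) ⟩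
    0ℤ                                           ∎
    where
    open ≡-Reasoning
    head-term : a *ℤ coeff Q i ≡ 0ℤ
    head-term with k ∣? s
    ... | yes k∣s = trans (cong (a *ℤ_) (Q-av i (∣m+n∣m⇒∣n (subst (k ∣_) (ℕP.+-assoc s t i) k∣) k∣s)))
                    (ℤP.*-zeroʳ a)
    ... | no  k∤s = cong (_*ℤ coeff Q i) (concentrated-head P-conc k∤s)
    shifted : Avoiding (s + t) (0ℤ ∷ (P *ₚ Q))
    shifted zero    _  = refl
    shifted (suc i) k∣ = *ₚ-concentrated-avoiding P Q (concentrated-tail P-conc) Q-av i (∣-+-suc (s + t) i k∣)

  *ₚ-avoiding-concentrated : ∀ P Q → Avoiding 0 P → Concentrated 0 Q → Avoiding 0 (P *ₚ Q)
  *ₚ-avoiding-concentrated P Q P-av Q-conc =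
    vanishesOn-cong (*ₚ-comm Q P) (*ₚ-concentrated-avoiding Q P Q-conc P-av)

  ^ₚ-concentrated : ∀ p n → Concentrated 0 p → Concentrated 0 (p ^ₚ n)
  ^ₚ-concentrated p zero    conc zero    k∤0 = ⊥-elim (k∤0 (k ∣0))
  ^ₚ-concentrated p zero    conc (suc i) _   = refl
  ^ₚ-concentrated p (suc n) conc = *ₚ-concentrated p (p ^ₚ n) conc (^ₚ-concentrated p n conc)

  coeff-padded : ∀ n p i → coeff (replicate n 0ℤ ++ p) (n + i) ≡ coeff p i
  coeff-padded zero    p i = refl
  coeff-padded (suc n) p i = coeff-padded n p i

  padded-concentrated : ∀ n {s} p → Concentrated (n + s) p → Concentrated s (replicate n 0ℤ ++ p)
  padded-concentrated zero    p conc = conc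
  padded-concentrated (suc n) p conc zero    _  = refl
  padded-concentrated (suc n) {s} p conc (suc i) k∤ =
    padded-concentrated n p (subst (λ r → Concentrated r p) (sym (ℕP.+-suc n s)) conc) i (k∤ ∘ ∣-suc-+ s i)

  ∘xpow-concentrated : ∀ {s} q → k ∣ s → Concentrated s (q ∘xpow k)
  ∘xpow-concentrated     []      k∣s i       _  = refl
  ∘xpow-concentrated {s} (a ∷ q) k∣s zero    k∤ = ⊥-elim (k∤ (subst (k ∣_) (sym (ℕP.+-identityʳ s)) k∣s))
  ∘xpow-concentrated {s} (a ∷ q) k∣s (suc i) k∤ =
    padded-concentrated m (q ∘xpow k) rest i (k∤ ∘ ∣-suc-+ s i)
    where
    rest : Concentrated (m + suc s) (q ∘xpow k)
    rest = subst (λ r → Concentrated r (q ∘xpow k)) (sym (ℕP.+-suc m s))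
                 (∘xpow-concentrated q (∣m∣n⇒∣m+n ∣-refl k∣s))

  coeff-∘xpow : ∀ q j → coeff (q ∘xpow k) (j * k) ≡ coeff q j
  coeff-∘xpow []      j       = refl
  coeff-∘xpow (a ∷ q) zero    = refl
  coeff-∘xpow (a ∷ q) (suc j) = trans (coeff-padded m (q ∘xpow k) (j * k)) (coeff-∘xpow q j)

  ∘xpow-≉0 : ∀ {q} → ¬ (q ≋ 0ₚ) → ¬ ((q ∘xpow k) ≋ 0ₚ)
  ∘xpow-≉0 {q} q≉0 (coeffwise q∘xpow≈0) = q≉0 (coeffwise λ j → trans (sym (coeff-∘xpow q j)) (q∘xpow≈0 (j * k)))

  stride : ℕ → Poly → Poly
  stride r       []      = []
  stride zero    (a ∷ p) = a ∷ stride m p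
  stride (suc r) (a ∷ p) = stride r p

  coeff-stride : ∀ r p j → coeff (stride r p) j ≡ coeff p (r + j * k)
  coeff-stride r       []      j       = refl
  coeff-stride zero    (a ∷ p) zero    = refl
  coeff-stride zero    (a ∷ p) (suc j) = coeff-stride m p j
  coeff-stride (suc r) (a ∷ p) j       = coeff-stride r p j

  decimate : Poly → Poly
  decimate = stride 0

  eval0-decimate-∘xpow : ∀ p → eval0 (decimate p ∘xpow k) ≡ eval0 p
  eval0-decimate-∘xpow p = trans (coeff-∘xpow (decimate p) 0) (coeff-stride 0 p 0)

  avoiding-sub-decimate : ∀ p → Avoiding 0 (p +ₚ (-ₚ (decimate p ∘xpow k)))
  avoiding-sub-decimate p _ (divides j refl) = begin
    coeff (p +ₚ (-ₚ P)) (j * k)              ≡⟨ coeff-−ₚ p P (j * k) ⟩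
    coeff p (j * k) +ℤ -ℤ coeff P (j * k)    ≡⟨ cong (λ c → coeff p (j * k) +ℤ -ℤ c) P≡p ⟩
    coeff p (j * k) +ℤ -ℤ coeff p (j * k)    ≡⟨ ℤP.+-inverseʳ (coeff p (j * k)) ⟩
    0ℤ                                       ∎
    where
    open ≡-Reasoning
    P : Poly
    P = decimate p ∘xpow k
    P≡p : coeff P (j * k) ≡ coeff p (j * k)
    P≡p = trans (coeff-∘xpow (decimate p) j) (coeff-stride 0 p j)

  concentrated-order : ∀ {p v} → Concentrated 0 p → p hasOrder v → k ∣ v
  concentrated-order {v = v} conc (order _ pᵥ≢0) = decidable-stable (k ∣? v) (λ k∤v → pᵥ≢0 (conc v k∤v))

  avoiding-factor≈0 : ∀ {u L D S W w} → Avoiding 0 u → Concentrated 0 D → eval0 L ≢ 0ℤ → eval0 S ≢ 0ℤ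
                      → Concentrated 0 W → W hasOrder w → (L *ₚ D) ≋ (u *ₚ (S *ₚ W)) → u ≋ 0ₚ
  avoiding-factor≈0 {u} {L} {D} {S} {W} {w} u-av D-conc L₀≢0 S₀≢0 W-conc ordW LD≈uSW
    with zero-or-hasOrder u
  ... | inj₁ u≈0        = u≈0
  ... | inj₂ (j , ordu) = ⊥-elim (coeff≢0 ordu (u-av j k∣j))
    where
    orduSW : (u *ₚ (S *ₚ W)) hasOrder (j + w)
    orduSW = *ₚ-hasOrder j ordu (*ₚ-hasOrder 0 (hasOrder-0 {S} S₀≢0) ordW)
    k∣j+w : k ∣ j + w
    k∣j+w with zero-or-hasOrder D
    ... | inj₁ D≈0 = ⊥-elim (coeff≢0 orduSW (coeff-≡ uSW≈0 (j + w)))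
      where
      uSW≈0 : (u *ₚ (S *ₚ W)) ≋ 0ₚ
      uSW≈0 = ≋-trans (≋-sym LD≈uSW) (≋-trans (*ₚ-congˡ L D≈0) (*ₚ-zeroʳ L))
    ... | inj₂ (e , ordD) = subst (k ∣_) (hasOrder-unique ordLD orduSW) (concentrated-order D-conc ordD)
      where
      ordLD : (u *ₚ (S *ₚ W)) hasOrder e
      ordLD = hasOrder-cong LD≈uSW (*ₚ-hasOrder 0 (hasOrder-0 {L} L₀≢0) ordD)
    k∣j : k ∣ j
    k∣j = ∣m+n∣m⇒∣n (subst (k ∣_) (ℕP.+-comm j w) k∣j+w) (concentrated-order W-conc ordW)

  avoiding-cross-difference : ∀ f₁ f₂ →
    Avoiding 0 ((f₁ *ₚ (decimate f₂ ∘xpow k)) +ₚ (-ₚ ((decimate f₁ ∘xpow k) *ₚ f₂)))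
  avoiding-cross-difference f₁ f₂ =
    vanishesOn-cong (regroup f₁ F₁ f₂ F₂)
      (+ₚ-vanishesOn ((f₁ +ₚ (-ₚ F₁)) *ₚ F₂) (-ₚ (F₁ *ₚ (f₂ +ₚ (-ₚ F₂))))
        (*ₚ-avoiding-concentrated (f₁ +ₚ (-ₚ F₁)) F₂
          (avoiding-sub-decimate f₁) (∘xpow-concentrated (decimate f₂) (k ∣0)))
        (·ₚ-vanishesOn -1ℤ (F₁ *ₚ (f₂ +ₚ (-ₚ F₂)))
          (*ₚ-concentrated-avoiding F₁ (f₂ +ₚ (-ₚ F₂))
            (∘xpow-concentrated (decimate f₁) (k ∣0)) (avoiding-sub-decimate f₂))))
    where
    F₁ F₂ : Poly
    F₁ = decimate f₁ ∘xpow k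
    F₂ = decimate f₂ ∘xpow k
    regroup : ∀ f₁ F₁ f₂ F₂ → (((f₁ +ₚ (-ₚ F₁)) *ₚ F₂) +ₚ (-ₚ (F₁ *ₚ (f₂ +ₚ (-ₚ F₂)))))
                              ≋ ((f₁ *ₚ F₂) +ₚ (-ₚ (F₁ *ₚ f₂)))
    regroup = solve-∀ ℤ[x]-solver

  cross-powers⇒≋ : ∀ X Y H₁ H₂ {c w} n → Avoiding 0 (X +ₚ (-ₚ Y)) → eval0 X ≡ c → eval0 Y ≡ c → c ≢ 0ℤ
                   → Concentrated 0 H₁ → Concentrated 0 H₂ → H₂ hasOrder w
                   → ((X ^ₚ suc n) *ₚ H₂) ≋ ((Y ^ₚ suc n) *ₚ H₁) → X ≋ Y
  cross-powers⇒≋ X Y H₁ H₂ n X-Y-av X₀≡c Y₀≡c c≢0 H₁-conc H₂-conc ordH₂ cross =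
    ≋-trans (split X Y) (+ₚ-cong X-Y≈0 (≋-refl {Y}))
    where
    S : Poly
    S = geomSum X Y (suc n)
    S₀≢0 : eval0 S ≢ 0ℤ
    S₀≢0 = *-≢0 {ℤ.+ suc n} (λ ()) (^-≢0 n c≢0) ∘ trans (sym (eval0-geomSum X Y n X₀≡c Y₀≡c))
    X-Y≈0 : (X +ₚ (-ₚ Y)) ≋ 0ₚ
    X-Y≈0 = avoiding-factor≈0 {L = Y ^ₚ suc n} {S = S} X-Y-av
              (+ₚ-vanishesOn H₁ (-ₚ H₂) H₁-conc (·ₚ-vanishesOn -1ℤ H₂ H₂-conc))
              (^ₚ-≢0 Y (suc n) (c≢0 ∘ trans (sym Y₀≡c))) S₀≢0 H₂-conc ordH₂
              (^ₚ-difference-factor X Y H₁ H₂ (suc n) cross)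
    split : ∀ X Y → X ≋ ((X +ₚ (-ₚ Y)) +ₚ Y)
    split = solve-∀ ℤ[x]-solver

  cross-multiplied-decimations : ∀ f₁ f₂ g₁ g₂ n → eval0 f₁ ≢ 0ℤ → eval0 f₂ ≢ 0ℤ → ¬ (g₂ ≋ 0ₚ)
    → ((f₁ ^ₚ suc n) *ₚ (g₂ ∘xpow k)) ≋ ((g₁ ∘xpow k) *ₚ (f₂ ^ₚ suc n))
    → (f₁ *ₚ (decimate f₂ ∘xpow k)) ≋ ((decimate f₁ ∘xpow k) *ₚ f₂)
  cross-multiplied-decimations f₁ f₂ g₁ g₂ n f₁₀≢0 f₂₀≢0 g₂≉0 hyp =
    cross-powers⇒≋ (f₁ *ₚ F₂) (F₁ *ₚ f₂) (G₁ *ₚ (F₂ ^ₚ suc n)) (G₂ *ₚ (F₁ ^ₚ suc n)) n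
      (avoiding-cross-difference f₁ f₂)
      (trans (eval0-*ₚ f₁ F₂) (cong (eval0 f₁ *ℤ_) (eval0-decimate-∘xpow f₂)))
      (trans (eval0-*ₚ F₁ f₂) (cong (_*ℤ eval0 f₂) (eval0-decimate-∘xpow f₁)))
      (*-≢0 f₁₀≢0 f₂₀≢0)
      (concentrated-cofactor g₁ f₂) (concentrated-cofactor g₂ f₁) (proj₂ ordH₂)
      (^ₚ-cross-multiply f₁ f₂ F₁ F₂ G₁ G₂ (suc n) hyp)
    where
    F₁ F₂ G₁ G₂ : Poly
    F₁ = decimate f₁ ∘xpow k
    F₂ = decimate f₂ ∘xpow k
    G₁ = g₁ ∘xpow k
    G₂ = g₂ ∘xpow k
    concentrated-cofactor : ∀ g f → Concentrated 0 ((g ∘xpow k) *ₚ ((decimate f ∘xpow k) ^ₚ suc n))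
    concentrated-cofactor g f =
      *ₚ-concentrated (g ∘xpow k) _ (∘xpow-concentrated g (k ∣0))
        (^ₚ-concentrated (decimate f ∘xpow k) (suc n) (∘xpow-concentrated (decimate f) (k ∣0)))
    ordH₂ : ∃ ((G₂ *ₚ (F₁ ^ₚ suc n)) hasOrder_)
    ordH₂ with ≉0⇒hasOrder (∘xpow-≉0 g₂≉0)
    ... | v , ordG₂ = v + 0 , *ₚ-hasOrder v ordG₂ (hasOrder-0 {F₁ ^ₚ suc n} F₁ⁿ⁺¹₀≢0)
      where
      F₁ⁿ⁺¹₀≢0 : eval0 (F₁ ^ₚ suc n) ≢ 0ℤ
      F₁ⁿ⁺¹₀≢0 = ^ₚ-≢0 F₁ (suc n) (f₁₀≢0 ∘ trans (sym (eval0-decimate-∘xpow f₁)))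

lemma24 : (f₁ f₂ g₁ g₂ : Poly) → (k n : ℕ) → k > 0 → n > 0
          → eval0 f₁ ≢ 0ℤ → eval0 f₂ ≢ 0ℤ → ¬ (g₂ ≈ₚ 0ₚ)
          → ((f₁ ^ₚ n) *ₚ (g₂ ∘xpow k)) ≈ₚ ((g₁ ∘xpow k) *ₚ (f₂ ^ₚ n))
          → Σ Poly (λ h₁ → Σ Poly (λ h₂ →
              ¬ (h₂ ≈ₚ 0ₚ) × ((f₁ *ₚ (h₂ ∘xpow k)) ≈ₚ ((h₁ ∘xpow k) *ₚ f₂))))
lemma24 f₁ f₂ g₁ g₂ (suc m) (suc n) _ _ f₁₀≢0 f₂₀≢0 g₂≉0 hyp =
  decimate f₁ , decimate f₂ , decimate-f₂≉0 ,
  coeff-≡ (cross-multiplied-decimations f₁ f₂ g₁ g₂ n f₁₀≢0 f₂₀≢0 (g₂≉0 ∘ coeff-≡) (coeffwise hyp))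
  where
  open Residues m
  decimate-f₂≉0 : ¬ (decimate f₂ ≈ₚ 0ₚ)
  decimate-f₂≉0 decimate-f₂≈0 = f₂₀≢0 (trans (sym (coeff-stride 0 f₂ 0)) (decimate-f₂≈0 0))
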